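{- For every natural number $n$, let $a(n)=\sum_{d\mid n,\ 1\le d\le\sqrt{n}} d$, the sum of the positive divisors of $n$ not exceeding $\sqrt{n}$. Then $a(n)$ is of average order $\sqrt{n}$; more precisely, $$\sum_{k=1}^n a(k)=\frac23 n\sqrt{n} + O(n\ln n)\quad\text{as } n\to\infty.$$
   Context: An arithmetic function $f(n)$ is said to be of average order $g(n)$ if $\sum_{k=1}^n f(k)\sim\sum_{k=1}^n g(k)$ as $n\to\infty$, where $F\sim G$ means $\lim F/G=1$. The notation $F(n)=O(G(n))$ means $|F(n)|\le C|G(n)|$ for some constant $C>0$ independent of $n$, for all sufficiently large $n$. -}

module Defs where

open import Data.Nat using (ℕ; suc; _*_; _≤?_)
open import Data.Nat.Divisibility using (_∣?_)
open import Data.List using (map; upTo)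
open import Data.Nat.ListAction using (sum)
open import Data.Bool using (if_then_else_)
open import Relation.Nullary.Decidable using (⌊_⌋)
open import Data.Bool using (_∧_)

a : ℕ → ℕ
a n = sum (map (λ d → if ⌊ d ∣? n ⌋ ∧ ⌊ d * d ≤? n ⌋ then d else 0) (map suc (upTo n)))

S : ℕ → ℕ
S n = sum (map (λ k → a (suc k)) (upTo n))

{-# OPTIONS --safe #-}
module Submission where

open import Defs
open import Data.Nat using (ℕ; _+_; _*_; _∸_; _^_; _≤_)
open import Data.Nat.Logarithm using (⌊log₂_⌋)
open import Data.Product using (Σ; _×_)

open import Data.Bool using (if_then_else_; _∧_)
open import Data.List using (map; upTo; [_]; _++_; _∷ʳ_)
open import Data.List.Properties using (upTo-∷ʳ; map-++; map-∘)
open import Data.Nat using (zero; suc; _<_; NonZero; z≤n; s≤s; s≤s⁻¹; >-nonZero⁻¹)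
open import Data.Nat.Divisibility using (_∣_; _∣?_; divides; ∣-refl; ∣m∣n⇒∣m+n)
open import Data.Nat.ListAction using (sum)
open import Data.Nat.ListAction.Properties using (sum-++)
open import Data.Nat.Logarithm using (⌊log₂⌋-mono-≤; ⌊log₂[2^n]⌋≡n)
open import Data.Nat.Properties
open import Data.Nat.Tactic.RingSolver using (solve-∀)
open import Algebra.Properties.CommutativeSemigroup +-commutativeSemigroup using (interchange; xy∙z≈xz∙y)
open import Data.Product using (_,_; proj₁; proj₂)
open import Data.Sum using (_⊎_; inj₁; inj₂)
open import Function using (_∘_)
open import Relation.Binary.PropositionalEquality
  using (_≡_; refl; sym; trans; cong; cong₂; subst; module ≡-Reasoning)
open import Relation.Nullary.Decidable using (Dec; ⌊_⌋; yes; no)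
open import Relation.Nullary.Negation using (¬_; contradiction)

-- Exchanging the order of summation, S(n) = Σ_{d ≤ √n} c_d(n) where
-- c_d(n) = Σ_{d² ≤ k ≤ n, d ∣ k} d.  When d² ≤ n, c_d(n) + d² is the least
-- multiple of d exceeding n, so n < c_d(n) + d² ≤ n + d.  Summing over
-- d ≤ m = ⌊√n⌋ gives m(n+1) ≤ S(n) + Σ d² ≤ mn + Σ d, and since Σ_{d ≤ m} d² ≈ m³/3
-- and n = m² + O(m), 3 S(n) lies within 5n of 2nm, while 2nm ≤ 2n√n < 2n(m+1).

Σ< : ℕ → (ℕ → ℕ) → ℕ
Σ< zero    f = 0
Σ< (suc n) f = Σ< n f + f n

sum-map-upTo : ∀ f n → sum (map f (upTo n)) ≡ Σ< n f
sum-map-upTo f zero    = refl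
sum-map-upTo f (suc n) = begin
  sum (map f (upTo (suc n)))        ≡⟨ cong (sum ∘ map f) (upTo-∷ʳ n) ⟨
  sum (map f (upTo n ∷ʳ n))         ≡⟨ cong sum (map-++ f (upTo n) [ n ]) ⟩
  sum (map f (upTo n) ++ [ f n ])   ≡⟨ sum-++ (map f (upTo n)) [ f n ] ⟩
  sum (map f (upTo n)) + (f n + 0)  ≡⟨ cong₂ _+_ (sum-map-upTo f n) (+-identityʳ (f n)) ⟩
  Σ< n f + f n                      ∎
  where open ≡-Reasoning

Σ<-cong : ∀ n {f g} → (∀ i → i < n → f i ≡ g i) → Σ< n f ≡ Σ< n g
Σ<-cong zero    f≡g = refl
Σ<-cong (suc n) f≡g = cong₂ _+_ (Σ<-cong n (λ i i<n → f≡g i (m<n⇒m<1+n i<n))) (f≡g n (n<1+n n))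

Σ<-mono-≤ : ∀ n {f g} → (∀ i → i < n → f i ≤ g i) → Σ< n f ≤ Σ< n g
Σ<-mono-≤ zero    f≤g = z≤n
Σ<-mono-≤ (suc n) f≤g = +-mono-≤ (Σ<-mono-≤ n (λ i i<n → f≤g i (m<n⇒m<1+n i<n))) (f≤g n (n<1+n n))

Σ<-distrib-+ : ∀ n f g → Σ< n (λ i → f i + g i) ≡ Σ< n f + Σ< n g
Σ<-distrib-+ zero    f g = refl
Σ<-distrib-+ (suc n) f g =
  trans (cong (_+ (f n + g n)) (Σ<-distrib-+ n f g)) (interchange (Σ< n f) (Σ< n g) (f n) (g n))

Σ<-const : ∀ n c → Σ< n (λ _ → c) ≡ n * c
Σ<-const zero    c = refl
Σ<-const (suc n) c = trans (cong (_+ c) (Σ<-const n c)) (+-comm (n * c) c)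

Σ<-comm : ∀ m n (F : ℕ → ℕ → ℕ) → Σ< m (λ i → Σ< n (F i)) ≡ Σ< n (λ j → Σ< m (λ i → F i j))
Σ<-comm zero    n F = sym (trans (Σ<-const n 0) (*-zeroʳ n))
Σ<-comm (suc m) n F =
  trans (cong (_+ Σ< n (F m)) (Σ<-comm m n F)) (sym (Σ<-distrib-+ n _ (F m)))

Σ<-truncate : ∀ {k n} f → k ≤ n → (∀ j → k ≤ j → j < n → f j ≡ 0) → Σ< n f ≡ Σ< k f
Σ<-truncate {n = zero} f z≤n vanish = refl
Σ<-truncate {k} {suc n} f k≤1+n vanish with m≤n⇒m<n∨m≡n k≤1+n
... | inj₂ refl    = refl
... | inj₁ k<1+n = begin
  Σ< n f + f n  ≡⟨ cong₂ _+_ (Σ<-truncate f k≤n (λ j k≤j j<n → vanish j k≤j (m<n⇒m<1+n j<n)))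
                             (vanish n k≤n (n<1+n n)) ⟩
  Σ< k f + 0    ≡⟨ +-identityʳ (Σ< k f) ⟩
  Σ< k f        ∎
  where
  open ≡-Reasoning
  k≤n : k ≤ n
  k≤n = s≤s⁻¹ k<1+n

a-term : ℕ → ℕ → ℕ
a-term d k = if ⌊ d ∣? k ⌋ ∧ ⌊ d * d ≤? k ⌋ then d else 0

a-term-∣ : ∀ {d k} → d ∣ k → d * d ≤ k → a-term d k ≡ d
a-term-∣ {d} {k} d∣k dd≤k with d ∣? k | d * d ≤? k
... | yes _   | yes _    = refl
... | yes _   | no dd≰k = contradiction dd≤k dd≰k
... | no d∤k  | _        = contradiction d∣k d∤k

a-term-∤ : ∀ {d k} → ¬ d ∣ k → a-term d k ≡ 0
a-term-∤ {d} {k} d∤k with d ∣? k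
... | yes d∣k = contradiction d∣k d∤k
... | no _    = refl

a-term-< : ∀ {d k} → k < d * d → a-term d k ≡ 0
a-term-< {d} {k} k<dd with d ∣? k | d * d ≤? k
... | yes _ | yes dd≤k = contradiction dd≤k (<⇒≱ k<dd)
... | yes _ | no _     = refl
... | no _  | _        = refl

a-term-cases : ∀ {d k} → d * d ≤ k → (d ∣ k × a-term d k ≡ d) ⊎ (¬ d ∣ k × a-term d k ≡ 0)
a-term-cases {d} {k} dd≤k = decide (d ∣? k)
  where
  decide : Dec (d ∣ k) → (d ∣ k × a-term d k ≡ d) ⊎ (¬ d ∣ k × a-term d k ≡ 0)
  decide (yes d∣k) = inj₁ (d∣k , a-term-∣ d∣k dd≤k)
  decide (no d∤k)  = inj₂ (d∤k , a-term-∤ d∤k)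

a-by-divisors : ∀ {k n} → k ≤ n → a k ≡ Σ< n (λ e → a-term (suc e) k)
a-by-divisors {k} {n} k≤n = begin
  a k                              ≡⟨ cong sum (map-∘ (upTo k)) ⟨
  sum (map (λ e → a-term (suc e) k) (upTo k)) ≡⟨ sum-map-upTo _ k ⟩
  Σ< k (λ e → a-term (suc e) k)   ≡⟨ Σ<-truncate _ k≤n (λ j k≤j _ → a-term-< (<-≤-trans (s≤s k≤j) (m≤m*n (suc j) (suc j)))) ⟨
  Σ< n (λ e → a-term (suc e) k)   ∎
  where open ≡-Reasoning

contribution : ℕ → ℕ → ℕ
contribution d n = Σ< n (λ i → a-term d (suc i))

S-by-divisors : ∀ n → S n ≡ Σ< n (λ e → contribution (suc e) n)
S-by-divisors n = begin
  S n                                                 ≡⟨ sum-map-upTo _ n ⟩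
  Σ< n (λ i → a (suc i))                              ≡⟨ Σ<-cong n (λ i i<n → a-by-divisors i<n) ⟩
  Σ< n (λ i → Σ< n (λ e → a-term (suc e) (suc i)))    ≡⟨ Σ<-comm n n _ ⟩
  Σ< n (λ e → contribution (suc e) n)                 ∎
  where open ≡-Reasoning

contribution-below : ∀ {d n} → n < d * d → contribution d n ≡ 0
contribution-below {d} n<dd = Σ<-truncate _ z≤n (λ j _ j<n → a-term-< {d} (≤-<-trans j<n n<dd))

S-by-small-divisors : ∀ {n} m → m * m ≤ n → n < suc m * suc m →
  S n ≡ Σ< m (λ e → contribution (suc e) n)
S-by-small-divisors {n} m mm≤n n<m'm' =
  trans (S-by-divisors n) (Σ<-truncate _ (≤-trans (m≤m*m m) mm≤n) large-vanish)
  where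
  m≤m*m : ∀ m → m ≤ m * m
  m≤m*m zero    = z≤n
  m≤m*m (suc m) = m≤m*n (suc m) (suc m)
  large-vanish : ∀ j → m ≤ j → j < n → contribution (suc j) n ≡ 0
  large-vanish j m≤j _ = contribution-below (<-≤-trans n<m'm' (*-mono-≤ (s≤s m≤j) (s≤s m≤j)))

LeastMultipleAbove : ℕ → ℕ → ℕ → Set
LeastMultipleAbove d n x = d ∣ x × n < x × x ≤ n + d

close-multiples-≡ : ∀ {d x y} .{{_ : NonZero d}} → d ∣ x → d ∣ y → y ≤ x → x < y + d → x ≡ y
close-multiples-≡ {d} (divides q refl) (divides p refl) pd≤qd qd<pd+d =
  cong (_* d) (≤-antisym (s≤s⁻¹ q<1+p) (*-cancelʳ-≤ p q d pd≤qd))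
  where
  q<1+p : q < suc p
  q<1+p = *-cancelʳ-< d q (suc p) (subst (q * d <_) (+-comm (p * d) d) qd<pd+d)

least-multiple-above-self : ∀ {d m} .{{_ : NonZero d}} → d ∣ m → LeastMultipleAbove d m (m + d)
least-multiple-above-self {d} {m} d∣m = ∣m∣n⇒∣m+n d∣m ∣-refl , m<m+n m (>-nonZero⁻¹ d) , ≤-refl

least-multiple-above-suc-∣ : ∀ {d n x} .{{_ : NonZero d}} → d ∣ suc n →
  LeastMultipleAbove d n x → LeastMultipleAbove d (suc n) (x + d)
least-multiple-above-suc-∣ {d} d∣1+n (d∣x , n<x , x≤n+d) =
  subst (λ y → LeastMultipleAbove d _ (y + d)) (sym (close-multiples-≡ d∣x d∣1+n n<x (s≤s x≤n+d)))
        (least-multiple-above-self d∣1+n)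

least-multiple-above-suc-∤ : ∀ {d n x} → ¬ d ∣ suc n →
  LeastMultipleAbove d n x → LeastMultipleAbove d (suc n) x
least-multiple-above-suc-∤ {d} d∤1+n (d∣x , n<x , x≤n+d) =
  d∣x , ≤∧≢⇒< n<x (λ 1+n≡x → d∤1+n (subst (d ∣_) (sym 1+n≡x) d∣x)) , m≤n⇒m≤1+n x≤n+d

contribution-least-multiple : ∀ {d} n .{{_ : NonZero d}} → d * d ≤ n →
  LeastMultipleAbove d n (contribution d n + d * d)
contribution-least-multiple {d} zero dd≤0 =
  contradiction (≤-trans (m≤m*n d d) dd≤0) (<⇒≱ (>-nonZero⁻¹ d))
contribution-least-multiple {d} (suc n) dd≤1+n with d * d ≤? n
... | no dd≰n = subst (LeastMultipleAbove d (suc n)) (sym first-term) (least-multiple-above-self d∣1+n)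
  where
  open ≡-Reasoning
  dd≡1+n : d * d ≡ suc n
  dd≡1+n = ≤-antisym dd≤1+n (≰⇒> dd≰n)
  d∣1+n : d ∣ suc n
  d∣1+n = divides d (sym dd≡1+n)
  first-term : contribution d (suc n) + d * d ≡ suc n + d
  first-term = begin
    contribution d n + a-term d (suc n) + d * d
      ≡⟨ cong₂ (λ c t → c + t + d * d) (contribution-below {d} (≰⇒> dd≰n)) (a-term-∣ d∣1+n dd≤1+n) ⟩
    d + d * d  ≡⟨ +-comm d (d * d) ⟩
    d * d + d  ≡⟨ cong (_+ d) dd≡1+n ⟩
    suc n + d  ∎
... | yes dd≤n with a-term-cases {d} dd≤1+n
...   | inj₁ (d∣1+n , term≡d) =
  subst (LeastMultipleAbove d (suc n)) (sym grows)
        (least-multiple-above-suc-∣ d∣1+n (contribution-least-multiple n dd≤n))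
  where
  grows : contribution d (suc n) + d * d ≡ contribution d n + d * d + d
  grows = trans (cong (λ t → contribution d n + t + d * d) term≡d) (xy∙z≈xz∙y _ d (d * d))
...   | inj₂ (d∤1+n , term≡0) =
  subst (LeastMultipleAbove d (suc n)) (sym stays)
        (least-multiple-above-suc-∤ d∤1+n (contribution-least-multiple n dd≤n))
  where
  stays : contribution d (suc n) + d * d ≡ contribution d n + d * d
  stays = cong (_+ d * d) (trans (cong (contribution d n +_) term≡0) (+-identityʳ _))

sumSquares : ℕ → ℕ
sumSquares m = Σ< m (λ e → suc e * suc e)

triangular : ℕ → ℕ
triangular m = Σ< m suc

S-sandwich : ∀ {n} m → m * m ≤ n → n < suc m * suc m →
  m * suc n ≤ S n + sumSquares m × S n + sumSquares m ≤ m * n + triangular m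
S-sandwich {n} m mm≤n n<m'm' = lower , upper
  where
  open ≤-Reasoning
  term : ℕ → ℕ
  term e = contribution (suc e) n + suc e * suc e
  split : S n + sumSquares m ≡ Σ< m term
  split = trans (cong (_+ sumSquares m) (S-by-small-divisors m mm≤n n<m'm')) (sym (Σ<-distrib-+ m _ _))
  bracket : ∀ e → e < m → LeastMultipleAbove (suc e) n (term e)
  bracket e e<m = contribution-least-multiple n (≤-trans (*-mono-≤ e<m e<m) mm≤n)
  lower : m * suc n ≤ S n + sumSquares m
  lower = begin
    m * suc n           ≡⟨ Σ<-const m (suc n) ⟨
    Σ< m (λ _ → suc n)  ≤⟨ Σ<-mono-≤ m (λ e e<m → proj₁ (proj₂ (bracket e e<m))) ⟩
    Σ< m term           ≡⟨ split ⟨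
    S n + sumSquares m  ∎
  upper : S n + sumSquares m ≤ m * n + triangular m
  upper = begin
    S n + sumSquares m             ≡⟨ split ⟩
    Σ< m term                      ≤⟨ Σ<-mono-≤ m (λ e e<m → proj₂ (proj₂ (bracket e e<m))) ⟩
    Σ< m (λ e → n + suc e)         ≡⟨ Σ<-distrib-+ m (λ _ → n) suc ⟩
    Σ< m (λ _ → n) + triangular m  ≡⟨ cong (_+ triangular m) (Σ<-const m n) ⟩
    m * n + triangular m           ∎

isqrt : ∀ n → Σ ℕ λ m → m * m ≤ n × n < suc m * suc m
isqrt zero = 0 , z≤n , s≤s z≤n
isqrt (suc n) with isqrt n
... | m , mm≤n , n<m'm' with suc m * suc m ≤? suc n
...   | yes m'm'≤1+n = suc m , m'm'≤1+n ,
    subst (_< suc (suc m) * suc (suc m)) (≤-antisym m'm'≤1+n n<m'm') (*-mono-< (n<1+n (suc m)) (n<1+n (suc m)))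
...   | no m'm'≰1+n  = m , m≤n⇒m≤1+n mm≤n , ≰⇒> m'm'≰1+n

triangular≤square : ∀ m → triangular m ≤ m * m
triangular≤square m = ≤-trans (Σ<-mono-≤ m (λ e e<m → e<m)) (≤-reflexive (Σ<-const m m))

cube≤3*sumSquares : ∀ m → m * (m * m) ≤ 3 * sumSquares m
cube≤3*sumSquares zero    = z≤n
cube≤3*sumSquares (suc m) = begin
  suc m * (suc m * suc m)                                   ≡⟨ expand m ⟩
  m * (m * m) + (3 * (m * m) + 3 * m + 1)                   ≤⟨ +-mono-≤ (cube≤3*sumSquares m) (m≤m+n _ (3 * m + 2)) ⟩
  3 * sumSquares m + (3 * (m * m) + 3 * m + 1 + (3 * m + 2)) ≡⟨ collect m (sumSquares m) ⟩
  3 * (sumSquares m + suc m * suc m)                        ∎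
  where
  open ≤-Reasoning
  expand : ∀ m → suc m * (suc m * suc m) ≡ m * (m * m) + (3 * (m * m) + 3 * m + 1)
  expand = solve-∀
  collect : ∀ m q → 3 * q + (3 * (m * m) + 3 * m + 1 + (3 * m + 2)) ≡ 3 * (q + suc m * suc m)
  collect = solve-∀

3*sumSquares≤[m+2]*m*m : ∀ m → 3 * sumSquares m ≤ (m + 2) * (m * m)
3*sumSquares≤[m+2]*m*m zero    = z≤n
3*sumSquares≤[m+2]*m*m (suc m) = begin
  3 * (sumSquares m + suc m * suc m)              ≡⟨ *-distribˡ-+ 3 (sumSquares m) (suc m * suc m) ⟩
  3 * sumSquares m + 3 * (suc m * suc m)          ≤⟨ +-monoˡ-≤ _ (3*sumSquares≤[m+2]*m*m m) ⟩
  (m + 2) * (m * m) + 3 * (suc m * suc m)         ≤⟨ m≤m+n _ m ⟩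
  (m + 2) * (m * m) + 3 * (suc m * suc m) + m     ≡⟨ collect m ⟩
  (suc m + 2) * (suc m * suc m)                   ∎
  where
  open ≤-Reasoning
  collect : ∀ m → (m + 2) * (m * m) + 3 * (suc m * suc m) + m ≡ (suc m + 2) * (suc m * suc m)
  collect = solve-∀

below-next-square : ∀ {n} m → n < suc m * suc m → n ≤ m * m + 2 * m
below-next-square {n} m n<m'm' = s≤s⁻¹ (subst (suc n ≤_) (square-suc m) n<m'm')
  where
  square-suc : ∀ m → suc m * suc m ≡ suc (m * m + 2 * m)
  square-suc = solve-∀

3*S-upper : ∀ {n} m → m * m ≤ n → n < suc m * suc m → 3 * S n ≤ 2 * n * m + 5 * n
3*S-upper {n} m mm≤n n<m'm' = +-cancelʳ-≤ (m * (m * m)) _ _ (begin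
  3 * S n + m * (m * m)                          ≤⟨ +-monoʳ-≤ (3 * S n) (cube≤3*sumSquares m) ⟩
  3 * S n + 3 * sumSquares m                     ≡⟨ *-distribˡ-+ 3 (S n) (sumSquares m) ⟨
  3 * (S n + sumSquares m)                       ≤⟨ *-monoʳ-≤ 3 (proj₂ (S-sandwich m mm≤n n<m'm')) ⟩
  3 * (m * n + triangular m)                     ≤⟨ *-monoʳ-≤ 3 (+-monoʳ-≤ (m * n) (triangular≤square m)) ⟩
  3 * (m * n + m * m)                            ≡⟨ regroup n m ⟩
  2 * n * m + m * n + 3 * (m * m)                ≤⟨ +-monoˡ-≤ _ (+-monoʳ-≤ (2 * n * m) (*-monoʳ-≤ m (below-next-square m n<m'm'))) ⟩
  2 * n * m + m * (m * m + 2 * m) + 3 * (m * m)  ≡⟨ collect n m ⟩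
  2 * n * m + 5 * (m * m) + m * (m * m)          ≤⟨ +-monoˡ-≤ _ (+-monoʳ-≤ (2 * n * m) (*-monoʳ-≤ 5 mm≤n)) ⟩
  2 * n * m + 5 * n + m * (m * m)                ∎)
  where
  open ≤-Reasoning
  regroup : ∀ n m → 3 * (m * n + m * m) ≡ 2 * n * m + m * n + 3 * (m * m)
  regroup = solve-∀
  collect : ∀ n m → 2 * n * m + m * (m * m + 2 * m) + 3 * (m * m) ≡ 2 * n * m + 5 * (m * m) + m * (m * m)
  collect = solve-∀

3*S-lower : ∀ {n} m → m * m ≤ n → n < suc m * suc m → 2 * n * suc m ≤ 3 * S n + 5 * n
3*S-lower {n} m mm≤n n<m'm' = +-cancelʳ-≤ ((m + 2) * (m * m)) _ _ (begin
  2 * n * suc m + (m + 2) * (m * m)            ≤⟨ +-monoʳ-≤ (2 * n * suc m) (*-monoʳ-≤ (m + 2) mm≤n) ⟩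
  2 * n * suc m + (m + 2) * n                  ≤⟨ m≤m+n _ (3 * m + n) ⟩
  2 * n * suc m + (m + 2) * n + (3 * m + n)    ≡⟨ collect n m ⟩
  3 * (m * suc n) + 5 * n                      ≤⟨ +-monoˡ-≤ (5 * n) (*-monoʳ-≤ 3 (proj₁ (S-sandwich m mm≤n n<m'm'))) ⟩
  3 * (S n + sumSquares m) + 5 * n             ≡⟨ regroup (S n) (sumSquares m) n ⟩
  3 * S n + 5 * n + 3 * sumSquares m           ≤⟨ +-monoʳ-≤ (3 * S n + 5 * n) (3*sumSquares≤[m+2]*m*m m) ⟩
  3 * S n + 5 * n + (m + 2) * (m * m)          ∎)
  where
  open ≤-Reasoning
  collect : ∀ n m → 2 * n * suc m + (m + 2) * n + (3 * m + n) ≡ 3 * (m * suc n) + 5 * n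
  collect = solve-∀
  regroup : ∀ s q n → 3 * (s + q) + 5 * n ≡ 3 * s + 5 * n + 3 * q
  regroup = solve-∀

squared-bounds : ∀ {n m x e} → m * m ≤ n → n < suc m * suc m →
  x ≤ 2 * n * m + e → 2 * n * suc m ≤ x + e →
  (x ∸ e) ^ 2 ≤ 4 * n ^ 3 × 4 * n ^ 3 ≤ (x + e) ^ 2
squared-bounds {n} {m} {x} {e} mm≤n n<m'm' x≤2nm+e 2n[m+1]≤x+e = lower , upper
  where
  open ≤-Reasoning
  -- The ring solver does not read _^_, so the powers are written out as their unfoldings.
  square : ∀ n k → (2 * n * k) * ((2 * n * k) * 1) ≡ 4 * (n * n) * (k * k)
  square = solve-∀
  cube : ∀ n → 4 * (n * (n * (n * 1))) ≡ 4 * (n * n) * n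
  cube = solve-∀
  lower : (x ∸ e) ^ 2 ≤ 4 * n ^ 3
  lower = begin
    (x ∸ e) ^ 2              ≤⟨ ^-monoˡ-≤ 2 (m≤n+o⇒m∸n≤o x e (subst (x ≤_) (+-comm (2 * n * m) e) x≤2nm+e)) ⟩
    (2 * n * m) ^ 2          ≡⟨ square n m ⟩
    4 * (n * n) * (m * m)    ≤⟨ *-monoʳ-≤ (4 * (n * n)) mm≤n ⟩
    4 * (n * n) * n          ≡⟨ cube n ⟨
    4 * n ^ 3                ∎
  upper : 4 * n ^ 3 ≤ (x + e) ^ 2
  upper = begin
    4 * n ^ 3                        ≡⟨ cube n ⟩
    4 * (n * n) * n                  ≤⟨ *-monoʳ-≤ (4 * (n * n)) (<⇒≤ n<m'm') ⟩
    4 * (n * n) * (suc m * suc m)    ≡⟨ square n (suc m) ⟨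
    (2 * n * suc m) ^ 2              ≤⟨ ^-monoˡ-≤ 2 2n[m+1]≤x+e ⟩
    (x + e) ^ 2                      ∎

n≤n*⌊log₂n⌋ : ∀ {n} → 2 ≤ n → n ≤ n * ⌊log₂ n ⌋
n≤n*⌊log₂n⌋ {n} 2≤n = subst (_≤ n * ⌊log₂ n ⌋) (*-identityʳ n) (*-monoʳ-≤ n 1≤⌊log₂n⌋)
  where
  1≤⌊log₂n⌋ : 1 ≤ ⌊log₂ n ⌋
  1≤⌊log₂n⌋ = subst (_≤ ⌊log₂ n ⌋) (⌊log₂[2^n]⌋≡n 1) (⌊log₂⌋-mono-≤ 2≤n)

theorem2p1 : Σ ℕ λ C → Σ ℕ λ N → (n : ℕ) → N ≤ n →
    ((3 * S n ∸ C * n * ⌊log₂ n ⌋) ^ 2 ≤ 4 * n ^ 3)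
      × (4 * n ^ 3 ≤ (3 * S n + C * n * ⌊log₂ n ⌋) ^ 2)
theorem2p1 = 5 , 2 , λ n 2≤n →
  let m , mm≤n , n<m'm' = isqrt n
      5n≤E : 5 * n ≤ 5 * n * ⌊log₂ n ⌋
      5n≤E = ≤-trans (*-monoʳ-≤ 5 (n≤n*⌊log₂n⌋ 2≤n)) (≤-reflexive (sym (*-assoc 5 n ⌊log₂ n ⌋)))
  in squared-bounds mm≤n n<m'm'
       (≤-trans (3*S-upper m mm≤n n<m'm') (+-monoʳ-≤ (2 * n * m) 5n≤E))
       (≤-trans (3*S-lower m mm≤n n<m'm') (+-monoʳ-≤ (3 * S n) 5n≤E))
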